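{- In System $\mathsf{F}_{<:}^{K\top}$, for every context $\Theta$, raw term $t$ and type $T$: $\Theta\vdash t:T$ is derivable if and only if $\Theta\vdash_M t:S$ is derivable for some type $S$ such that $\Theta\vdash S<:T$. (In particular, every typable term has a minimal type.)
   Context: System $\mathsf{F}_{<:}^{K\top}$. Raw types: $T ::= \top \mid X \mid T\to T \mid \forall^{K}(X<:T).T \mid \forall^{\top}(X<:T).T$ (up to $\alpha$-conversion). Raw terms: $t ::= \mathsf{top}\mid x\mid \lambda(x:T).t\mid \Lambda(X<:T).t\mid t\,t\mid t\{T\}$. Contexts are finite sequences of $X<:T$ and $x:T$ with the usual well-formedness judgments $\Theta\vdash T$. Subtyping $\Theta\vdash S<:T$ is generated by: (Var) $\Theta,X<:T,\Theta'\vdash X<:T$; (Top) $\Theta\vdash T<:\top$; (Refl); (Trans); ($\to$) contravariant in the domain, covariant in the codomain; ($\forall$-Fun) from $\Theta,X<:S\vdash T<:T'$ infer $\Theta\vdash\forall^K(X<:S).T<:\forall^K(X<:S).T'$; ($\forall$-Loc) from $\Theta\vdash T_0<:S_0$ and $\Theta,X<:S_0\vdash S_1<:T_1$ infer $\Theta\vdash\forall^K(X<:S_0).S_1<:\forall^\top(X<:T_0).T_1$; ($\forall$-Top) from $\Theta\vdash T_0<:S_0$ and $\Theta,X<:\top\vdash S_1<:T_1$ infer $\Theta\vdash\forall^\top(X<:S_0).S_1<:\forall^\top(X<:T_0).T_1$. Typing $\Theta\vdash t:T$: $\Theta\vdash\mathsf{top}:\top$; $\Theta,x:T,\Theta'\vdash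 x:T$; subsumption; $\lambda$-introduction $\Theta\vdash\lambda(x:S).t:S\to T$ from $\Theta,x:S\vdash t:T$; application; ($\forall$-i) $\Theta\vdash\Lambda(X<:S).t:\forall^K(X<:S).T$ from $\Theta,X<:S\vdash t:T$; ($\forall$-e) $\Theta\vdash t\{S'\}:T[S'/X]$ from $\Theta\vdash t:\forall^\top(X<:S).T$ and $\Theta\vdash S'<:S$. For a type $\Theta\vdash T$ define $\Theta^*(T)=\Theta^*(S)$ if $T$ is a type variable $X$ and $\Theta=\Theta',X<:S,\Theta''$, and $\Theta^*(T)=T$ otherwise. Minimal typing judgments $\Theta\vdash_M t:T$ are generated by: $\Theta,x:T,\Theta'\vdash_M x:T$; $\Theta\vdash_M\mathsf{top}:\top$; from $\Theta,x:S\vdash_M t:T$ infer $\Theta\vdash_M\lambda(x:S).t:S\to T$; from $\Theta\vdash_M r:R$, $\Theta\vdash_M s:S$, $\Theta\vdash S<:S'$ with $\Theta^*(R)=S'\to T$ infer $\Theta\vdash_M r\,s:T$; from $\Theta,X<:S\vdash_M t:T$ infer $\Theta\vdash_M\Lambda(X<:S).t:\forall^K(X<:S).T$; from $\Theta\vdash_M r:R$ and $\Theta\vdash S<:S'$ with $\Theta^*(R)=\forall^K(X<:S').T$ or $\Theta^*(R)=\forall^\top(X<:S').T$ infer $\Theta\vdash_M r\{S\}:T[S/X]$. -}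

module Defs where

open import Data.Nat using (ℕ; zero; suc)
open import Data.Fin using (Fin; zero; suc)
open import Relation.Binary.PropositionalEquality using (_≡_)

-- Syntax of System F<:^{K⊤}, intrinsically scoped (de Bruijn indices),
-- so raw types/terms are automatically taken up to α-conversion.

data Kd : Set where
  kK kTop : Kd

data Ty (n : ℕ) : Set where
  ⊤′   : Ty n
  tvar : Fin n → Ty n
  _⇒_  : Ty n → Ty n → Ty n
  all  : Kd → Ty n → Ty (suc n) → Ty n   -- all k S T  =  ∀^k (X <: S). T

infixr 7 _⇒_

data Tm (n m : ℕ) : Set where
  top  : Tm n m
  var  : Fin m → Tm n m
  lam  : Ty n → Tm n (suc m) → Tm n m
  Lam  : Ty n → Tm (suc n) m → Tm n m
  app  : Tm n m → Tm n m → Tm n m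
  tapp : Tm n m → Ty n → Tm n m

ext : ∀ {n k} → (Fin n → Fin k) → Fin (suc n) → Fin (suc k)
ext ρ zero    = zero
ext ρ (suc i) = suc (ρ i)

ren : ∀ {n k} → (Fin n → Fin k) → Ty n → Ty k
ren ρ ⊤′         = ⊤′
ren ρ (tvar i)   = tvar (ρ i)
ren ρ (S ⇒ T)    = ren ρ S ⇒ ren ρ T
ren ρ (all k S T) = all k (ren ρ S) (ren (ext ρ) T)

wk : ∀ {n} → Ty n → Ty (suc n)
wk = ren suc

exts : ∀ {n k} → (Fin n → Ty k) → Fin (suc n) → Ty (suc k)
exts σ zero    = tvar zero
exts σ (suc i) = wk (σ i)

sub : ∀ {n k} → (Fin n → Ty k) → Ty n → Ty k
sub σ ⊤′          = ⊤′
sub σ (tvar i)    = σ i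
sub σ (S ⇒ T)     = sub σ S ⇒ sub σ T
sub σ (all k S T) = all k (sub σ S) (sub (exts σ) T)

-- T [ S / X ]  where X is the outermost-bound (index 0) variable of T
single : ∀ {n} → Ty n → Fin (suc n) → Ty n
single S zero    = S
single S (suc i) = tvar i

_[_] : ∀ {n} → Ty (suc n) → Ty n → Ty n
T [ S ] = sub (single S) T

data Ctx : ℕ → ℕ → Set where
  ε     : Ctx zero zero
  _,<:_ : ∀ {n m} → Ctx n m → Ty n → Ctx (suc n) m
  _,∶_  : ∀ {n m} → Ctx n m → Ty n → Ctx n (suc m)

infixl 5 _,<:_ _,∶_
infix 4 _⊢_<:_ _⊢_∶_ _⊢M_∶_

bound : ∀ {n m} → Ctx n m → Fin n → Ty n
bound (Θ ,<: S) zero    = wk S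
bound (Θ ,<: S) (suc X) = wk (bound Θ X)
bound (Θ ,∶ U)  X       = bound Θ X

tyOf : ∀ {n m} → Ctx n m → Fin m → Ty n
tyOf (Θ ,<: S) x       = wk (tyOf Θ x)
tyOf (Θ ,∶ U)  zero    = U
tyOf (Θ ,∶ U)  (suc x) = tyOf Θ x

-- Θ*(T): follow type-variable bounds until a non-variable is reached
promote : ∀ {n m} → Ctx n m → Ty n → Ty n
promote (Θ ,<: S) (tvar zero)    = wk (promote Θ S)
promote (Θ ,<: S) (tvar (suc X)) = wk (promote Θ (tvar X))
promote (Θ ,<: S) ⊤′             = ⊤′
promote (Θ ,<: S) (A ⇒ B)        = A ⇒ B
promote (Θ ,<: S) (all k A B)    = all k A B
promote (Θ ,∶ U)  T              = promote Θ T
promote ε         T              = T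

data _⊢_<:_ {n m} (Θ : Ctx n m) : Ty n → Ty n → Set where
  s-var   : ∀ X → Θ ⊢ tvar X <: bound Θ X
  s-top   : ∀ T → Θ ⊢ T <: ⊤′
  s-refl  : ∀ T → Θ ⊢ T <: T
  s-trans : ∀ {S T U} → Θ ⊢ S <: T → Θ ⊢ T <: U → Θ ⊢ S <: U
  s-arr   : ∀ {S S′ T T′} → Θ ⊢ S′ <: S → Θ ⊢ T <: T′ → Θ ⊢ S ⇒ T <: S′ ⇒ T′
  s-fun   : ∀ {S T T′} → (Θ ,<: S) ⊢ T <: T′ → Θ ⊢ all kK S T <: all kK S T′
  s-loc   : ∀ {S₀ S₁ T₀ T₁} → Θ ⊢ T₀ <: S₀ → (Θ ,<: S₀) ⊢ S₁ <: T₁ →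
            Θ ⊢ all kK S₀ S₁ <: all kTop T₀ T₁
  s-alltop : ∀ {S₀ S₁ T₀ T₁} → Θ ⊢ T₀ <: S₀ → (Θ ,<: ⊤′) ⊢ S₁ <: T₁ →
            Θ ⊢ all kTop S₀ S₁ <: all kTop T₀ T₁

data _⊢_∶_ {n m} (Θ : Ctx n m) : Tm n m → Ty n → Set where
  t-top  : Θ ⊢ top ∶ ⊤′
  t-var  : ∀ x → Θ ⊢ var x ∶ tyOf Θ x
  t-sub  : ∀ {t S T} → Θ ⊢ t ∶ S → Θ ⊢ S <: T → Θ ⊢ t ∶ T
  t-lam  : ∀ {S t T} → (Θ ,∶ S) ⊢ t ∶ T → Θ ⊢ lam S t ∶ (S ⇒ T)
  t-app  : ∀ {r s S T} → Θ ⊢ r ∶ (S ⇒ T) → Θ ⊢ s ∶ S → Θ ⊢ app r s ∶ T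
  t-Lam  : ∀ {S t T} → (Θ ,<: S) ⊢ t ∶ T → Θ ⊢ Lam S t ∶ all kK S T
  t-tapp : ∀ {t S T S′} → Θ ⊢ t ∶ all kTop S T → Θ ⊢ S′ <: S →
           Θ ⊢ tapp t S′ ∶ (T [ S′ ])

data _⊢M_∶_ {n m} (Θ : Ctx n m) : Tm n m → Ty n → Set where
  m-var  : ∀ x → Θ ⊢M var x ∶ tyOf Θ x
  m-top  : Θ ⊢M top ∶ ⊤′
  m-lam  : ∀ {S t T} → (Θ ,∶ S) ⊢M t ∶ T → Θ ⊢M lam S t ∶ (S ⇒ T)
  m-app  : ∀ {r s R S S′ T} → Θ ⊢M r ∶ R → Θ ⊢M s ∶ S → Θ ⊢ S <: S′ →
           promote Θ R ≡ (S′ ⇒ T) → Θ ⊢M app r s ∶ T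
  m-Lam  : ∀ {S t T} → (Θ ,<: S) ⊢M t ∶ T → Θ ⊢M Lam S t ∶ all kK S T
  m-tappK : ∀ {r R S S′ T} → Θ ⊢M r ∶ R → Θ ⊢ S <: S′ →
           promote Θ R ≡ all kK S′ T → Θ ⊢M tapp r S ∶ (T [ S ])
  m-tappTop : ∀ {r R S S′ T} → Θ ⊢M r ∶ R → Θ ⊢ S <: S′ →
           promote Θ R ≡ all kTop S′ T → Θ ⊢M tapp r S ∶ (T [ S ])

-- Soundness: each minimal rule is admissible in the declarative system, because
-- Θ ⊢ R <: Θ*(R) and ∀^K (X<:S).T <: ∀^⊤ (X<:S).T.  Completeness is by induction on the
-- typing derivation, subsumption being absorbed into the trailing subtyping.  For
-- applications one inverts subtyping: if Θ ⊢ A <: C and Θ*(C) is an arrow (a quantifier),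
-- then so is Θ*(A), with componentwise subtyping.  The only non-trivial composition in
-- this inversion is ∀^K <: ∀^⊤ <: ∀^⊤, where the body of the second step lives under
-- X <: ⊤ and must be narrowed to X <: S.  The body of a type application is then
-- compared by the substitution lemma for subtyping.
module Submission where

open import Defs
open import Data.Nat using (ℕ)
open import Data.Fin using (Fin; zero; suc)
open import Data.Product using (Σ; _×_; _,_)
open import Function.Bundles using (_⇔_; mk⇔)
open import Relation.Binary.PropositionalEquality
  using (_≡_; refl; sym; trans; cong; cong₂; subst; subst₂)

private
  variable
    a b c n m m′ : ℕ
    Θ : Ctx n m
    Δ : Ctx a m′
    k k′ k″ : Kd
    A B C D E S S′ S″ T T′ T″ U : Ty n

ren-cong : {ρ τ : Fin a → Fin b} → (∀ i → ρ i ≡ τ i) → ∀ A → ren ρ A ≡ ren τ A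
ren-cong h ⊤′          = refl
ren-cong h (tvar i)    = cong tvar (h i)
ren-cong h (A ⇒ B)     = cong₂ _⇒_ (ren-cong h A) (ren-cong h B)
ren-cong h (all k A B) = cong₂ (all k) (ren-cong h A) (ren-cong ext-cong B)
  where
  ext-cong : ∀ i → ext _ i ≡ ext _ i
  ext-cong zero    = refl
  ext-cong (suc i) = cong suc (h i)

sub-cong : {σ τ : Fin a → Ty b} → (∀ i → σ i ≡ τ i) → ∀ A → sub σ A ≡ sub τ A
sub-cong h ⊤′          = refl
sub-cong h (tvar i)    = h i
sub-cong h (A ⇒ B)     = cong₂ _⇒_ (sub-cong h A) (sub-cong h B)
sub-cong h (all k A B) = cong₂ (all k) (sub-cong h A) (sub-cong exts-cong B)
  where
  exts-cong : ∀ i → exts _ i ≡ exts _ i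
  exts-cong zero    = refl
  exts-cong (suc i) = cong wk (h i)

ren-ren : (ρ : Fin b → Fin c) (ρ′ : Fin a → Fin b) (A : Ty a) →
          ren ρ (ren ρ′ A) ≡ ren (λ i → ρ (ρ′ i)) A
ren-ren ρ ρ′ ⊤′          = refl
ren-ren ρ ρ′ (tvar i)    = refl
ren-ren ρ ρ′ (A ⇒ B)     = cong₂ _⇒_ (ren-ren ρ ρ′ A) (ren-ren ρ ρ′ B)
ren-ren ρ ρ′ (all k A B) = cong₂ (all k) (ren-ren ρ ρ′ A)
  (trans (ren-ren (ext ρ) (ext ρ′) B) (ren-cong ext-∘ B))
  where
  ext-∘ : ∀ i → ext ρ (ext ρ′ i) ≡ ext (λ j → ρ (ρ′ j)) i
  ext-∘ zero    = refl
  ext-∘ (suc i) = refl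

sub-ren : (σ : Fin b → Ty c) (ρ : Fin a → Fin b) (A : Ty a) →
          sub σ (ren ρ A) ≡ sub (λ i → σ (ρ i)) A
sub-ren σ ρ ⊤′          = refl
sub-ren σ ρ (tvar i)    = refl
sub-ren σ ρ (A ⇒ B)     = cong₂ _⇒_ (sub-ren σ ρ A) (sub-ren σ ρ B)
sub-ren σ ρ (all k A B) = cong₂ (all k) (sub-ren σ ρ A)
  (trans (sub-ren (exts σ) (ext ρ) B) (sub-cong exts-∘-ext B))
  where
  exts-∘-ext : ∀ i → exts σ (ext ρ i) ≡ exts (λ j → σ (ρ j)) i
  exts-∘-ext zero    = refl
  exts-∘-ext (suc i) = refl

ren-sub : (ρ : Fin b → Fin c) (σ : Fin a → Ty b) (A : Ty a) →
          ren ρ (sub σ A) ≡ sub (λ i → ren ρ (σ i)) A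
ren-sub ρ σ ⊤′          = refl
ren-sub ρ σ (tvar i)    = refl
ren-sub ρ σ (A ⇒ B)     = cong₂ _⇒_ (ren-sub ρ σ A) (ren-sub ρ σ B)
ren-sub ρ σ (all k A B) = cong₂ (all k) (ren-sub ρ σ A)
  (trans (ren-sub (ext ρ) (exts σ) B) (sub-cong ext-∘-exts B))
  where
  ext-∘-exts : ∀ i → ren (ext ρ) (exts σ i) ≡ exts (λ j → ren ρ (σ j)) i
  ext-∘-exts zero    = refl
  ext-∘-exts (suc i) = trans (ren-ren (ext ρ) suc (σ i)) (sym (ren-ren suc ρ (σ i)))

sub-id : (A : Ty n) → sub tvar A ≡ A
sub-id ⊤′          = refl
sub-id (tvar i)    = refl
sub-id (A ⇒ B)     = cong₂ _⇒_ (sub-id A) (sub-id B)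
sub-id (all k A B) = cong₂ (all k) (sub-id A) (trans (sub-cong exts-id B) (sub-id B))
  where
  exts-id : ∀ i → exts tvar i ≡ tvar i
  exts-id zero    = refl
  exts-id (suc i) = refl

ren-ext-wk : (ρ : Fin a → Fin b) (A : Ty a) → ren (ext ρ) (wk A) ≡ wk (ren ρ A)
ren-ext-wk ρ A = trans (ren-ren (ext ρ) suc A) (sym (ren-ren suc ρ A))

sub-exts-wk : (σ : Fin a → Ty b) (A : Ty a) → sub (exts σ) (wk A) ≡ wk (sub σ A)
sub-exts-wk σ A = trans (sub-ren (exts σ) suc A) (sym (ren-sub suc σ A))

wk-[] : (A : Ty n) (S : Ty n) → wk A [ S ] ≡ A
wk-[] A S = trans (sub-ren (single S) suc A) (sub-id A)

BoundPreserving : Ctx n m → Ctx a m′ → (Fin n → Fin a) → Set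
BoundPreserving Θ Δ ρ = ∀ X → bound Δ (ρ X) ≡ ren ρ (bound Θ X)

BoundPreserving-ext : {ρ : Fin n → Fin a} → BoundPreserving Θ Δ ρ → ∀ S →
                      BoundPreserving (Θ ,<: S) (Δ ,<: ren ρ S) (ext ρ)
BoundPreserving-ext {ρ = ρ} h S zero = sym (ren-ext-wk ρ S)
BoundPreserving-ext {Θ = Θ} {ρ = ρ} h S (suc X) =
  trans (cong wk (h X)) (sym (ren-ext-wk ρ (bound Θ X)))

ren-<: : {ρ : Fin n → Fin a} → BoundPreserving Θ Δ ρ →
         Θ ⊢ A <: B → Δ ⊢ ren ρ A <: ren ρ B
ren-<: {Δ = Δ} {ρ = ρ} h (s-var X) = subst (Δ ⊢ tvar (ρ X) <:_) (h X) (s-var (ρ X))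
ren-<: h (s-top T)        = s-top _
ren-<: h (s-refl T)       = s-refl _
ren-<: h (s-trans p q)    = s-trans (ren-<: h p) (ren-<: h q)
ren-<: h (s-arr p q)      = s-arr (ren-<: h p) (ren-<: h q)
ren-<: h (s-fun {S} p)    = s-fun (ren-<: (BoundPreserving-ext h S) p)
ren-<: h (s-loc {S₀} p q) = s-loc (ren-<: h p) (ren-<: (BoundPreserving-ext h S₀) q)
ren-<: h (s-alltop p q)   = s-alltop (ren-<: h p) (ren-<: (BoundPreserving-ext h ⊤′) q)

wk-<: : ∀ U → Θ ⊢ A <: B → (Θ ,<: U) ⊢ wk A <: wk B
wk-<: U = ren-<: (λ X → refl)

BoundRespecting : Ctx n m → Ctx a m′ → (Fin n → Ty a) → Set
BoundRespecting Θ Δ σ = ∀ X → Δ ⊢ σ X <: sub σ (bound Θ X)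

BoundRespecting-exts : {σ : Fin n → Ty a} → BoundRespecting Θ Δ σ → ∀ S →
                       BoundRespecting (Θ ,<: S) (Δ ,<: sub σ S) (exts σ)
BoundRespecting-exts {Δ = Δ} {σ = σ} h S zero =
  subst (Δ ,<: sub σ S ⊢ tvar zero <:_) (sym (sub-exts-wk σ S)) (s-var zero)
BoundRespecting-exts {Θ = Θ} {Δ = Δ} {σ = σ} h S (suc X) =
  subst (Δ ,<: sub σ S ⊢ wk (σ X) <:_) (sym (sub-exts-wk σ (bound Θ X))) (wk-<: _ (h X))

sub-<: : {σ : Fin n → Ty a} → BoundRespecting Θ Δ σ →
         Θ ⊢ A <: B → Δ ⊢ sub σ A <: sub σ B
sub-<: h (s-var X)        = h X
sub-<: h (s-top T)        = s-top _
sub-<: h (s-refl T)       = s-refl _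
sub-<: h (s-trans p q)    = s-trans (sub-<: h p) (sub-<: h q)
sub-<: h (s-arr p q)      = s-arr (sub-<: h p) (sub-<: h q)
sub-<: h (s-fun {S} p)    = s-fun (sub-<: (BoundRespecting-exts h S) p)
sub-<: h (s-loc {S₀} p q) = s-loc (sub-<: h p) (sub-<: (BoundRespecting-exts h S₀) q)
sub-<: h (s-alltop p q)   = s-alltop (sub-<: h p) (sub-<: (BoundRespecting-exts h ⊤′) q)

narrow-<: : {Δ : Ctx n m′} → (∀ X → Δ ⊢ tvar X <: bound Θ X) →
            Θ ⊢ A <: B → Δ ⊢ A <: B
narrow-<: {A = A} {B = B} {Δ = Δ} h p =
  subst₂ (Δ ⊢_<:_) (sub-id A) (sub-id B)
    (sub-<: (λ X → subst (Δ ⊢ tvar X <:_) (sym (sub-id _)) (h X)) p)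

term-wk-<: : ∀ U → Θ ⊢ A <: B → Θ ,∶ U ⊢ A <: B
term-wk-<: U = narrow-<: s-var

term-strengthen-<: : Θ ,∶ U ⊢ A <: B → Θ ⊢ A <: B
term-strengthen-<: = narrow-<: s-var

narrow-⊤-<: : ∀ S → Θ ,<: ⊤′ ⊢ A <: B → Θ ,<: S ⊢ A <: B
narrow-⊤-<: S = narrow-<: λ { zero → s-top _ ; (suc X) → s-var (suc X) }

[]-<: : Θ ⊢ S′ <: S → Θ ,<: S ⊢ A <: B → Θ ⊢ A [ S′ ] <: B [ S′ ]
[]-<: {Θ = Θ} {S′ = S′} {S = S} s = sub-<: single-respects
  where
  single-respects : BoundRespecting (Θ ,<: S) Θ (single S′)
  single-respects zero    = subst (Θ ⊢ S′ <:_) (sym (wk-[] S S′)) s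
  single-respects (suc X) = subst (Θ ⊢ tvar X <:_) (sym (wk-[] (bound Θ X) S′)) (s-var X)

promote-⊤′ : (Θ : Ctx n m) → promote Θ ⊤′ ≡ ⊤′
promote-⊤′ ε         = refl
promote-⊤′ (Θ ,<: S) = refl
promote-⊤′ (Θ ,∶ U)  = promote-⊤′ Θ

promote-⇒ : (Θ : Ctx n m) (A B : Ty n) → promote Θ (A ⇒ B) ≡ A ⇒ B
promote-⇒ ε         A B = refl
promote-⇒ (Θ ,<: S) A B = refl
promote-⇒ (Θ ,∶ U)  A B = promote-⇒ Θ A B

promote-all : (Θ : Ctx n m) (k : Kd) (A : Ty n) (B : Ty _) →
              promote Θ (all k A B) ≡ all k A B
promote-all ε         k A B = refl
promote-all (Θ ,<: S) k A B = refl
promote-all (Θ ,∶ U)  k A B = promote-all Θ k A B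

promote-wk : (Θ : Ctx n m) (S A : Ty n) → promote (Θ ,<: S) (wk A) ≡ wk (promote Θ A)
promote-wk Θ S ⊤′          = cong wk (sym (promote-⊤′ Θ))
promote-wk Θ S (tvar X)    = refl
promote-wk Θ S (A ⇒ B)     = cong wk (sym (promote-⇒ Θ A B))
promote-wk Θ S (all k A B) = cong wk (sym (promote-all Θ k A B))

promote-tvar : (Θ : Ctx n m) (X : Fin n) → promote Θ (tvar X) ≡ promote Θ (bound Θ X)
promote-tvar (Θ ,<: S) zero    = sym (promote-wk Θ S S)
promote-tvar (Θ ,<: S) (suc X) =
  trans (cong wk (promote-tvar Θ X)) (sym (promote-wk Θ S (bound Θ X)))
promote-tvar (Θ ,∶ U)  X       = promote-tvar Θ X

<:-promote : (Θ : Ctx n m) (A : Ty n) → Θ ⊢ A <: promote Θ A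
<:-promote ε         A              = s-refl A
<:-promote (Θ ,∶ U)  A              = term-wk-<: U (<:-promote Θ A)
<:-promote (Θ ,<: S) (tvar zero)    = s-trans (s-var zero) (wk-<: S (<:-promote Θ S))
<:-promote (Θ ,<: S) (tvar (suc X)) = wk-<: S (<:-promote Θ (tvar X))
<:-promote (Θ ,<: S) ⊤′             = s-refl _
<:-promote (Θ ,<: S) (A ⇒ B)        = s-refl _
<:-promote (Θ ,<: S) (all k A B)    = s-refl _

promote≡⇒<: : promote Θ A ≡ B → Θ ⊢ A <: B
promote≡⇒<: {Θ = Θ} {A = A} refl = <:-promote Θ A

data AllSub (Θ : Ctx n m) : Kd → Ty n → Ty _ → Kd → Ty n → Ty _ → Set where
  fun : Θ ,<: S ⊢ T <: T′ → AllSub Θ kK S T kK S T′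
  loc : Θ ⊢ S′ <: S → Θ ,<: S ⊢ T <: T′ → AllSub Θ kK S T kTop S′ T′
  top : Θ ⊢ S′ <: S → Θ ,<: ⊤′ ⊢ T <: T′ → AllSub Θ kTop S T kTop S′ T′

AllSub-refl : ∀ k S T → AllSub Θ k S T k S T
AllSub-refl kK   S T = fun (s-refl T)
AllSub-refl kTop S T = top (s-refl S) (s-refl T)

AllSub-trans : AllSub Θ k S T k′ S′ T′ → AllSub Θ k′ S′ T′ k″ S″ T″ →
               AllSub Θ k S T k″ S″ T″
AllSub-trans (fun p)   (fun q)    = fun (s-trans p q)
AllSub-trans (fun p)   (loc s q)  = loc s (s-trans p q)
AllSub-trans (loc s p) (top s′ q) = loc (s-trans s′ s) (s-trans p (narrow-⊤-<: _ q))
AllSub-trans (top s p) (top s′ q) = top (s-trans s′ s) (s-trans p q)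

PromotesToAllBelow : Ctx n m → Ty n → Kd → Ty n → Ty (ℕ.suc n) → Set
PromotesToAllBelow {n} Θ A k S T =
  Σ Kd λ k′ → Σ (Ty n) λ S′ → Σ (Ty (ℕ.suc n)) λ T′ →
    (promote Θ A ≡ all k′ S′ T′) × AllSub Θ k′ S′ T′ k S T

<:-all-inv : Θ ⊢ A <: C → promote Θ C ≡ all k S T → PromotesToAllBelow Θ A k S T
<:-all-inv {Θ = Θ} {k = k} {S = S} {T = T} (s-var X) e =
  k , S , T , trans (promote-tvar Θ X) e , AllSub-refl k S T
<:-all-inv {k = k} {S = S} {T = T} (s-refl _) e = k , S , T , e , AllSub-refl k S T
<:-all-inv (s-trans p q) e with <:-all-inv q e
... | _ , _ , _ , e′ , r′ with <:-all-inv p e′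
...   | k′ , S′ , T′ , e″ , r = k′ , S′ , T′ , e″ , AllSub-trans r r′
<:-all-inv {Θ = Θ} (s-top _) e with trans (sym (promote-⊤′ Θ)) e
... | ()
<:-all-inv {Θ = Θ} (s-arr {S′ = D} {T′ = E} p q) e with trans (sym (promote-⇒ Θ D E)) e
... | ()
<:-all-inv {Θ = Θ} (s-fun {S} {T} {T′} p) e with trans (sym (promote-all Θ kK S T′)) e
... | refl = kK , S , T , promote-all Θ kK S T , fun p
<:-all-inv {Θ = Θ} (s-loc {S₀} {S₁} {T₀} {T₁} p q) e
  with trans (sym (promote-all Θ kTop T₀ T₁)) e
... | refl = kK , S₀ , S₁ , promote-all Θ kK S₀ S₁ , loc p q
<:-all-inv {Θ = Θ} (s-alltop {S₀} {S₁} {T₀} {T₁} p q) e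
  with trans (sym (promote-all Θ kTop T₀ T₁)) e
... | refl = kTop , S₀ , S₁ , promote-all Θ kTop S₀ S₁ , top p q

PromotesToArrowBelow : Ctx n m → Ty n → Ty n → Ty n → Set
PromotesToArrowBelow {n} Θ A D E =
  Σ (Ty n) λ D′ → Σ (Ty n) λ E′ →
    (promote Θ A ≡ D′ ⇒ E′) × (Θ ⊢ D <: D′) × (Θ ⊢ E′ <: E)

<:-⇒-inv : Θ ⊢ A <: C → promote Θ C ≡ D ⇒ E → PromotesToArrowBelow Θ A D E
<:-⇒-inv {Θ = Θ} {D = D} {E = E} (s-var X) e =
  D , E , trans (promote-tvar Θ X) e , s-refl D , s-refl E
<:-⇒-inv {D = D} {E = E} (s-refl _) e = D , E , e , s-refl D , s-refl E
<:-⇒-inv (s-trans p q) e with <:-⇒-inv q e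
... | _ , _ , e′ , d′ , f′ with <:-⇒-inv p e′
...   | D′ , E′ , e″ , d , f = D′ , E′ , e″ , s-trans d′ d , s-trans f f′
<:-⇒-inv {Θ = Θ} (s-arr {S} {S′} {T} {T′} p q) e with trans (sym (promote-⇒ Θ S′ T′)) e
... | refl = S , T , promote-⇒ Θ S T , p , q
<:-⇒-inv {Θ = Θ} (s-top _) e with trans (sym (promote-⊤′ Θ)) e
... | ()
<:-⇒-inv {Θ = Θ} (s-fun {S} {T} {T′} p) e with trans (sym (promote-all Θ kK S T′)) e
... | ()
<:-⇒-inv {Θ = Θ} (s-loc {T₀ = T₀} {T₁} p q) e with trans (sym (promote-all Θ kTop T₀ T₁)) e
... | ()
<:-⇒-inv {Θ = Θ} (s-alltop {T₀ = T₀} {T₁} p q) e with trans (sym (promote-all Θ kTop T₀ T₁)) e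
... | ()

⊢M⇒⊢ : ∀ {t} → Θ ⊢M t ∶ T → Θ ⊢ t ∶ T
⊢M⇒⊢ (m-var x) = t-var x
⊢M⇒⊢ m-top     = t-top
⊢M⇒⊢ (m-lam d) = t-lam (⊢M⇒⊢ d)
⊢M⇒⊢ (m-Lam d) = t-Lam (⊢M⇒⊢ d)
⊢M⇒⊢ (m-app r s p e) = t-app (t-sub (⊢M⇒⊢ r) (promote≡⇒<: e)) (t-sub (⊢M⇒⊢ s) p)
⊢M⇒⊢ (m-tappK {S′ = S′} {T} r p e) =
  t-tapp (t-sub (⊢M⇒⊢ r) (s-trans (promote≡⇒<: e) (s-loc (s-refl S′) (s-refl T)))) p
⊢M⇒⊢ (m-tappTop r p e) = t-tapp (t-sub (⊢M⇒⊢ r) (promote≡⇒<: e)) p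

MinimallyTyped : Ctx n m → Tm n m → Ty n → Set
MinimallyTyped {n} Θ t T = Σ (Ty n) λ S → (Θ ⊢M t ∶ S) × (Θ ⊢ S <: T)

⊢⇒⊢M : ∀ {t} → Θ ⊢ t ∶ T → MinimallyTyped Θ t T
⊢⇒⊢M t-top     = ⊤′ , m-top , s-refl ⊤′
⊢⇒⊢M (t-var x) = _ , m-var x , s-refl _
⊢⇒⊢M (t-sub d p) with ⊢⇒⊢M d
... | S , m , q = S , m , s-trans q p
⊢⇒⊢M (t-lam {S} d) with ⊢⇒⊢M d
... | T , m , q = S ⇒ T , m-lam m , s-arr (s-refl S) (term-strengthen-<: q)
⊢⇒⊢M (t-Lam {S} d) with ⊢⇒⊢M d
... | T , m , q = all kK S T , m-Lam m , s-fun q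
⊢⇒⊢M {Θ = Θ} (t-app {S = S} {T} dr ds) with ⊢⇒⊢M dr | ⊢⇒⊢M ds
... | R , mr , qr | S₀ , ms , qs with <:-⇒-inv qr (promote-⇒ Θ S T)
...   | D , E , e , d , f = E , m-app mr ms (s-trans qs d) e , f
⊢⇒⊢M {Θ = Θ} (t-tapp {S = S} {T} {S′} d p) with ⊢⇒⊢M d
... | R , mr , q with <:-all-inv q (promote-all Θ kTop S T)
...   | kK , _ , T₀ , e , loc s r =
        T₀ [ S′ ] , m-tappK mr (s-trans p s) e , []-<: (s-trans p s) r
...   | kTop , _ , T₀ , e , top s r =
        T₀ [ S′ ] , m-tappTop mr (s-trans p s) e , []-<: (s-top S′) r

mainTheorem4 : ∀ {n m} (Θ : Ctx n m) (t : Tm n m) (T : Ty n) →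
    (Θ ⊢ t ∶ T) ⇔ Σ (Ty n) (λ S → (Θ ⊢M t ∶ S) × (Θ ⊢ S <: T))
mainTheorem4 Θ t T = mk⇔ ⊢⇒⊢M λ { (S , m , p) → t-sub (⊢M⇒⊢ m) p }
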